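{- Let $n\ge 4$ and $V=\mathbb{F}_2^n$. Let $H$, $\mathcal{A},\mathcal{B},\mathcal{C}$, $X^c$ and $h:\mathcal{C}(n,2)_2\to\mathcal{G}_2(V)$ be as defined in the context. Then $h$ is adjacency preserving: if $X,Y\in\mathcal{C}(n,2)_2$ are adjacent (i.e. $X\cap Y$ is $1$-dimensional), then $h(X)$ and $h(Y)$ are adjacent.
   Context: $V=\mathbb{F}_2^n$, $C_i=\{x\in V:x_i=0\}$, $\mathcal{G}_2(V)$ is the set of $2$-dimensional subspaces, and $\mathcal{C}(n,2)_2$ is the set of $2$-dimensional subspaces contained in no $C_i$. Two $2$-dimensional subspaces are adjacent if their intersection is $1$-dimensional. For non-empty $I\subset\{1,\dots,n\}$, $P_I$ is the $1$-dimensional subspace spanned by the vector whose $i$-th coordinate is $1$ for $i\in I$ and $0$ otherwise; $I^c=\{1,\dots,n\}\setminus I$. Let $H$ be the hyperplane of $V$ spanned by all $P_I$ with $I$ an $(n-1)$-element subset of $\{1,\dots,n\}$ containing $n$. Let $\mathcal{A}$ be the set of elements of $\mathcal{C}(n,2)_2$ containing $P_{\{1,\dots,n\}}$, $\mathcal{B}$ the set of elements of $\mathcal{C}(n,2)_2$ contained in $H$, and $\mathcal{C}=\mathcal{C}(n,2)_2\setminus(\mathcal{A}\cup\mathcal{B})$. For $X\in\mathcal{C}$, $X\cap H$ is $1$-dimensional; let $P_I,P_J$ be the other two $1$-dimensional subspaces of $X$, and let $X^c=P_{I^c}+P_{J^c}$ (a $2$-dimensional subspace). The map $h$ fixes every element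 of $\mathcal{A}\cup\mathcal{B}$ and sends each $X\in\mathcal{C}$ to $X^c$. -}

module Defs where

open import Data.Bool using (Bool; true; false; not; if_then_else_; _xor_)
open import Data.Nat using (ℕ; suc; _<_)
open import Data.Fin using (Fin; toℕ; _≟_)
open import Data.Vec using (Vec; []; _∷_; replicate; zipWith; tabulate; lookup)
open import Data.Product using (Σ; ∃; _×_; _,_; proj₁)
open import Data.Sum using (_⊎_)
open import Relation.Nullary using (¬_; does)
open import Relation.Binary.PropositionalEquality using (_≡_; _≢_)
open import Function.Bundles using (_⇔_)

Vect : ℕ → Set
Vect n = Vec Bool n

zeroV : ∀ {n} → Vect n
zeroV = replicate _ false

onesV : ∀ {n} → Vect n
onesV = replicate _ true

_⊕_ : ∀ {n} → Vect n → Vect n → Vect n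
_⊕_ = zipWith _xor_

lin : ∀ {n k} → Vec Bool k → Vec (Vect n) k → Vect n
lin [] [] = zeroV
lin (c ∷ cs) (g ∷ gs) = if c then g ⊕ lin cs gs else lin cs gs

InSpan : ∀ {n k} → Vec (Vect n) k → Vect n → Set
InSpan gs v = ∃ λ c → v ≡ lin c gs

Independent : ∀ {n k} → Vec (Vect n) k → Set
Independent gs = ∀ c → lin c gs ≡ zeroV → c ≡ replicate _ false

-- 𝒢₂(V): 2-dimensional subspaces, presented by a basis (two independent vectors)
G2 : ℕ → Set
G2 n = Σ (Vec (Vect n) 2) Independent

_∈S_ : ∀ {n} → Vect n → G2 n → Set
v ∈S X = InSpan (proj₁ X) v

-- X ∩ Y is 1-dimensional: X ∩ Y = span{p} for some nonzero (independent) p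
Adjacent : ∀ {n} → G2 n → G2 n → Set
Adjacent X Y = ∃ λ p → Independent (p ∷ []) × p ∈S X × p ∈S Y
  × (∀ v → v ∈S X → v ∈S Y → InSpan (p ∷ []) v)

-- C_i = {x : x_i = 0};  𝒞(n,2)₂ : 2-subspaces contained in no C_i
InC : ∀ {n} → G2 n → Set
InC {n} X = ∀ (i : Fin n) → ¬ (∀ v → v ∈S X → lookup v i ≡ false)

-- P_I for I = {1..n} ∖ {i}: the complement of the i-th unit vector
coUnit : ∀ {n} → Fin n → Vect n
coUnit i = tabulate λ j → not (does (j ≟ i))

-- H: the span of all P_I with |I| = n-1 and n ∈ I, i.e. I = {1..n}∖{i}, i ≠ n
-- (coordinate n is the index with toℕ i = n-1; coefficients of it are forced false)
InH : ∀ {n} → Vect n → Set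
InH {n} x = ∃ λ (c : Vec Bool n) →
  (∀ i → lookup c i ≡ true → suc (toℕ i) < n) × x ≡ lin c (tabulate coUnit)

-- 𝒜 : contains P_{1..n};  ℬ : contained in H
InA : ∀ {n} → G2 n → Set
InA X = onesV ∈S X

InB : ∀ {n} → G2 n → Set
InB X = ∀ v → v ∈S X → InH v

InCC : ∀ {n} → G2 n → Set
InCC X = InC X × ¬ InA X × ¬ InB X

SameSpace : ∀ {n k} → Vec (Vect n) 2 → Vec (Vect n) k → Set
SameSpace xs ys = ∀ v → InSpan xs v ⇔ InSpan ys v

-- the graph of h : h(X) = Z.
-- On 𝒜 ∪ ℬ, h is the identity; on 𝒞, with P_I, P_J the two vectors of X
-- outside H, h(X) = P_{Iᶜ} + P_{Jᶜ}  (complement of I ↔ xor with all-ones).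
HMap : ∀ {n} → G2 n → G2 n → Set
HMap X Z =
  ((InA X ⊎ InB X) × SameSpace (proj₁ Z) (proj₁ X))
  ⊎ (InCC X × ∃ λ p → ∃ λ q → p ∈S X × q ∈S X × ¬ InH p × ¬ InH q × p ≢ q
       × SameSpace (proj₁ Z) ((p ⊕ onesV) ∷ (q ⊕ onesV) ∷ []))

{-# OPTIONS --safe #-}
-- Since 1 ∉ H, V = H ⊕ ⟨1⟩; let π be the projection onto H along ⟨1⟩, so π x = x on H
-- and π x = x + 1 off H. Then h(X) = X when 1 ∈ X and h(X) = π(X) otherwise: trivially on ℬ,
-- and on 𝒞 because P_{Iᶜ} = P_I + 1. Let X ∩ Y = ⟨s⟩. If 1 ∈ X but 1 ∉ Y, then X is a union of
-- cosets of ⟨1⟩, whence X ∩ π(Y) = ⟨π s⟩. If 1 lies in neither, π x = π y forces y = x or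
-- y = x + 1, and the second is impossible for x ∈ X, y ∈ Y in 𝒞(n,2)₂; so π(X) ∩ π(Y) = ⟨π s⟩.

module Submission where

open import Defs
open import Data.Nat using (ℕ; _≤_; zero; suc; s≤s; _<_)
open import Data.Nat.Properties using (n≮n)
open import Data.Bool using (Bool; true; false; if_then_else_; _xor_)
open import Data.Bool.Properties
  using (xor-assoc; xor-comm; xor-identityˡ; xor-identityʳ; xor-same)
open import Data.Fin using (Fin; toℕ; fromℕ; lower₁) renaming (zero to fzero; suc to fsuc)
open import Data.Fin.Properties using (toℕ-injective; toℕ-fromℕ; toℕ<n; toℕ-lower₁)
open import Data.Vec using (Vec; []; _∷_; replicate; tabulate; lookup; map)
open import Data.Vec.Properties
  using ( zipWith-assoc; zipWith-comm; zipWith-identityˡ; zipWith-identityʳ; zipWith-inverseˡ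
        ; zipWith-replicate; lookup-zipWith; lookup-replicate; map-id; tabulate-∘; tabulate∘lookup
        ; tabulate-cong)
open import Data.Product using (Σ; ∃; _×_; _,_; proj₁; proj₂)
open import Data.Sum using (_⊎_; inj₁; inj₂; [_,_]′)
import Data.Sum as Sum
open import Function using (case_of_; _∘_; id)
open import Function.Bundles using (mk⇔; Equivalence)
import Function.Properties.Equivalence as ⇔
open import Level using (0ℓ)
open import Algebra.Bundles using (CommutativeSemigroup)
import Algebra.Properties.CommutativeSemigroup as CommutativeSemigroupProperties
open import Relation.Nullary using (¬_; contradiction)
open import Relation.Binary.PropositionalEquality
  using (_≡_; _≢_; refl; sym; trans; cong; cong₂; subst; module ≡-Reasoning)
open import Relation.Binary.PropositionalEquality.Algebra using (isMagma)

open Equivalence using (to; from)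
open ≡-Reasoning

⊕-assoc : ∀ {n} (x y z : Vect n) → (x ⊕ y) ⊕ z ≡ x ⊕ (y ⊕ z)
⊕-assoc = zipWith-assoc xor-assoc

⊕-comm : ∀ {n} (x y : Vect n) → x ⊕ y ≡ y ⊕ x
⊕-comm = zipWith-comm xor-comm

⊕-identityˡ : ∀ {n} (x : Vect n) → zeroV ⊕ x ≡ x
⊕-identityˡ = zipWith-identityˡ xor-identityˡ

⊕-identityʳ : ∀ {n} (x : Vect n) → x ⊕ zeroV ≡ x
⊕-identityʳ = zipWith-identityʳ xor-identityʳ

⊕-self : ∀ {n} (x : Vect n) → x ⊕ x ≡ zeroV
⊕-self x = trans (cong (_⊕ x) (sym (map-id x))) (zipWith-inverseˡ xor-same x)

⊕-commutativeSemigroup : ℕ → CommutativeSemigroup 0ℓ 0ℓ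
⊕-commutativeSemigroup n = record
  { _∙_                    = _⊕_ {n}
  ; isCommutativeSemigroup = record
    { isSemigroup = record { isMagma = isMagma _⊕_ ; assoc = ⊕-assoc }
    ; comm        = ⊕-comm
    }
  }

⊕-interchange : ∀ {n} (w x y z : Vect n) → (w ⊕ x) ⊕ (y ⊕ z) ≡ (w ⊕ y) ⊕ (x ⊕ z)
⊕-interchange {n} = CommutativeSemigroupProperties.interchange (⊕-commutativeSemigroup n)

⊕-leftComm : ∀ {n} (x y z : Vect n) → x ⊕ (y ⊕ z) ≡ y ⊕ (x ⊕ z)
⊕-leftComm {n} = CommutativeSemigroupProperties.x∙yz≈y∙xz (⊕-commutativeSemigroup n)

⊕-cancelˡ : ∀ {n} (x y : Vect n) → x ⊕ (x ⊕ y) ≡ y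
⊕-cancelˡ x y = begin
  x ⊕ (x ⊕ y)  ≡⟨ sym (⊕-assoc x x y) ⟩
  (x ⊕ x) ⊕ y  ≡⟨ cong (_⊕ y) (⊕-self x) ⟩
  zeroV ⊕ y    ≡⟨ ⊕-identityˡ y ⟩
  y            ∎

⊕-cancelʳ : ∀ {n} (x y : Vect n) → (x ⊕ y) ⊕ y ≡ x
⊕-cancelʳ x y = trans (⊕-comm (x ⊕ y) y) (trans (cong (y ⊕_) (⊕-comm x y)) (⊕-cancelˡ y x))

⊕-moveˡ : ∀ {n} {x y z : Vect n} → x ⊕ y ≡ z → y ≡ x ⊕ z
⊕-moveˡ {x = x} {y} x⊕y≡z = trans (sym (⊕-cancelˡ x y)) (cong (x ⊕_) x⊕y≡z)

⊕≡zero⇒≡ : ∀ {n} {x y : Vect n} → x ⊕ y ≡ zeroV → x ≡ y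
⊕≡zero⇒≡ {x = x} x⊕y≡0 = sym (trans (⊕-moveˡ x⊕y≡0) (⊕-identityʳ x))

replicate-⊕ : ∀ {n} r s → replicate n r ⊕ replicate n s ≡ replicate n (r xor s)
replicate-⊕ = zipWith-replicate _xor_

lookup-⊕ : ∀ {n} (x y : Vect n) i → lookup (x ⊕ y) i ≡ lookup x i xor lookup y i
lookup-⊕ x y i = lookup-zipWith _xor_ i x y

lookup-extensional : ∀ {n} {x y : Vect n} → (∀ i → lookup x i ≡ lookup y i) → x ≡ y
lookup-extensional {x = x} {y} eq =
  trans (sym (tabulate∘lookup x)) (trans (tabulate-cong eq) (tabulate∘lookup y))

-- Spans and additive maps

Additive : ∀ {m n} → (Vect m → Vect n) → Set
Additive f = ∀ x y → f (x ⊕ y) ≡ f x ⊕ f y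

additive-zero : ∀ {m n} {f : Vect m → Vect n} → Additive f → f zeroV ≡ zeroV
additive-zero {f = f} f-add =
  trans (trans (cong f (sym (⊕-self zeroV))) (f-add zeroV zeroV)) (⊕-self (f zeroV))

lin-additive : ∀ {n k} (gs : Vec (Vect n) k) → Additive (λ c → lin c gs)
lin-additive [] [] [] = sym (⊕-self zeroV)
lin-additive (g ∷ gs) (true ∷ c) (true ∷ d) = begin
  lin (c ⊕ d) gs                      ≡⟨ lin-additive gs c d ⟩
  lin c gs ⊕ lin d gs                 ≡⟨ sym (⊕-identityˡ _) ⟩
  zeroV ⊕ (lin c gs ⊕ lin d gs)       ≡⟨ cong (_⊕ (lin c gs ⊕ lin d gs)) (sym (⊕-self g)) ⟩
  (g ⊕ g) ⊕ (lin c gs ⊕ lin d gs)     ≡⟨ ⊕-interchange g g (lin c gs) (lin d gs) ⟩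
  (g ⊕ lin c gs) ⊕ (g ⊕ lin d gs)     ∎
lin-additive (g ∷ gs) (true ∷ c) (false ∷ d) =
  trans (cong (g ⊕_) (lin-additive gs c d)) (sym (⊕-assoc g (lin c gs) (lin d gs)))
lin-additive (g ∷ gs) (false ∷ c) (true ∷ d) =
  trans (cong (g ⊕_) (lin-additive gs c d)) (⊕-leftComm g (lin c gs) (lin d gs))
lin-additive (g ∷ gs) (false ∷ c) (false ∷ d) = lin-additive gs c d

additive-lin : ∀ {m n k} {f : Vect m → Vect n} → Additive f →
               ∀ c (gs : Vec (Vect m) k) → f (lin c gs) ≡ lin c (map f gs)
additive-lin f-add [] [] = additive-zero f-add
additive-lin {f = f} f-add (true ∷ c) (g ∷ gs) =
  trans (f-add g (lin c gs)) (cong (f g ⊕_) (additive-lin f-add c gs))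
additive-lin f-add (false ∷ c) (g ∷ gs) = additive-lin f-add c gs

additive-InSpan : ∀ {m n k} {f : Vect m → Vect n} {gs : Vec (Vect m) k} {v} →
                  Additive f → InSpan gs v → InSpan (map f gs) (f v)
additive-InSpan {gs = gs} f-add (c , refl) = c , additive-lin f-add c gs

InSpan-map⁻ : ∀ {m n k} {f : Vect m → Vect n} {gs : Vec (Vect m) k} {v} →
              Additive f → InSpan (map f gs) v → ∃ λ x → InSpan gs x × v ≡ f x
InSpan-map⁻ {gs = gs} f-add (c , refl) = lin c gs , (c , refl) , sym (additive-lin f-add c gs)

additive-Independent : ∀ {m n k} {f : Vect m → Vect n} {gs : Vec (Vect m) k} → Additive f →
                       (∀ x → InSpan gs x → f x ≡ zeroV → x ≡ zeroV) →
                       Independent gs → Independent (map f gs)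
additive-Independent {gs = gs} f-add ker-trivial ind c fc≡0 =
  ind c (ker-trivial (lin c gs) (c , refl) (trans (additive-lin f-add c gs) fc≡0))

additive-Independent⁻ : ∀ {m n k} {f : Vect m → Vect n} {gs : Vec (Vect m) k} → Additive f →
                        Independent (map f gs) → Independent gs
additive-Independent⁻ {f = f} {gs} f-add ind c c≡0 =
  ind c (trans (sym (additive-lin f-add c gs)) (trans (cong f c≡0) (additive-zero f-add)))

InSpan-zero : ∀ {n k} (gs : Vec (Vect n) k) → InSpan gs zeroV
InSpan-zero gs = zeroV , sym (additive-zero (lin-additive gs))

InSpan-⊕ : ∀ {n k} {gs : Vec (Vect n) k} {x y} → InSpan gs x → InSpan gs y → InSpan gs (x ⊕ y)
InSpan-⊕ {gs = gs} (c , refl) (d , refl) = c ⊕ d , sym (lin-additive gs c d)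

infix 4 _⊆ˢ_

_⊆ˢ_ : ∀ {n k l} → Vec (Vect n) k → Vec (Vect n) l → Set
xs ⊆ˢ ys = ∀ v → InSpan xs v → InSpan ys v

⊆ˢ-fromGenerators : ∀ {n k l} {xs : Vec (Vect n) k} {ys : Vec (Vect n) l} →
                    (∀ i → InSpan ys (lookup xs i)) → xs ⊆ˢ ys
⊆ˢ-fromGenerators {xs = []} {ys} _ _ ([] , refl) = InSpan-zero ys
⊆ˢ-fromGenerators {xs = x ∷ xs} gens _ (true ∷ c , refl) =
  InSpan-⊕ (gens fzero) (⊆ˢ-fromGenerators (gens ∘ fsuc) _ (c , refl))
⊆ˢ-fromGenerators {xs = x ∷ xs} gens _ (false ∷ c , refl) =
  ⊆ˢ-fromGenerators (gens ∘ fsuc) _ (c , refl)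

additive-⊆ˢ : ∀ {m n k l} {f : Vect m → Vect n} {xs : Vec (Vect m) k} {ys : Vec (Vect m) l} →
              Additive f → xs ⊆ˢ ys → map f xs ⊆ˢ map f ys
additive-⊆ˢ f-add xs⊆ys v v∈fxs with InSpan-map⁻ f-add v∈fxs
... | x , x∈xs , refl = additive-InSpan f-add (xs⊆ys x x∈xs)

⊆ˢ-antisym : ∀ {n l} {xs : Vec (Vect n) 2} {ys : Vec (Vect n) l} →
             xs ⊆ˢ ys → ys ⊆ˢ xs → SameSpace xs ys
⊆ˢ-antisym xs⊆ys ys⊆xs v = mk⇔ (xs⊆ys v) (ys⊆xs v)

SameSpace-trans : ∀ {n l} {xs ys : Vec (Vect n) 2} {zs : Vec (Vect n) l} →
                  SameSpace xs ys → SameSpace ys zs → SameSpace xs zs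
SameSpace-trans xs≈ys ys≈zs v = ⇔.trans (xs≈ys v) (ys≈zs v)

lookup-lin≡false : ∀ {n k} (c : Vec Bool k) {gs : Vec (Vect n) k} i →
                   (∀ j → lookup (lookup gs j) i ≡ false) → lookup (lin c gs) i ≡ false
lookup-lin≡false [] {[]} i _ = lookup-replicate i false
lookup-lin≡false (true ∷ c) {g ∷ gs} i vanish =
  trans (lookup-⊕ g (lin c gs) i)
        (cong₂ _xor_ (vanish fzero) (lookup-lin≡false c i (vanish ∘ fsuc)))
lookup-lin≡false (false ∷ c) {g ∷ gs} i vanish = lookup-lin≡false c i (vanish ∘ fsuc)

InSpan-lookup≡false : ∀ {n k} {gs : Vec (Vect n) k} {v i} → InSpan gs v →
                      (∀ j → lookup (lookup gs j) i ≡ false) → lookup v i ≡ false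
InSpan-lookup≡false (c , refl) = lookup-lin≡false c _

independent-single : ∀ {n} {p : Vect n} → p ≢ zeroV → Independent (p ∷ [])
independent-single p≢0 (false ∷ []) _ = refl
independent-single {p = p} p≢0 (true ∷ []) p≡0 = contradiction (trans (sym (⊕-identityʳ p)) p≡0) p≢0

independent-single⁻ : ∀ {n} {p : Vect n} → Independent (p ∷ []) → p ≢ zeroV
independent-single⁻ {p = p} ind p≡0 = case ind (true ∷ []) (trans (⊕-identityʳ p) p≡0) of λ ()

independent-pair : ∀ {n} {u v : Vect n} → u ≢ zeroV → v ≢ zeroV → u ≢ v → Independent (u ∷ v ∷ [])
independent-pair _ _ _ (false ∷ false ∷ []) _ = refl
independent-pair {u = u} u≢0 _ _ (true ∷ false ∷ []) e = contradiction (trans (sym (⊕-identityʳ u)) e) u≢0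
independent-pair {v = v} _ v≢0 _ (false ∷ true ∷ []) e = contradiction (trans (sym (⊕-identityʳ v)) e) v≢0
independent-pair {u = u} {v} _ _ u≢v (true ∷ true ∷ []) e =
  contradiction (trans (⊕≡zero⇒≡ e) (⊕-identityʳ v)) u≢v

𝔽₂²-units : ∀ {c d : Vect 2} → Independent (c ∷ d ∷ []) →
            InSpan (c ∷ d ∷ []) (true ∷ false ∷ []) × InSpan (c ∷ d ∷ []) (false ∷ true ∷ [])
𝔽₂²-units {false ∷ false ∷ []} ind = case ind (true ∷ false ∷ []) refl of λ ()
𝔽₂²-units {_} {false ∷ false ∷ []} ind = case ind (false ∷ true ∷ []) refl of λ ()
𝔽₂²-units {true ∷ false ∷ []} {true ∷ false ∷ []} ind = case ind (true ∷ true ∷ []) refl of λ ()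
𝔽₂²-units {false ∷ true ∷ []} {false ∷ true ∷ []} ind = case ind (true ∷ true ∷ []) refl of λ ()
𝔽₂²-units {true ∷ true ∷ []} {true ∷ true ∷ []} ind = case ind (true ∷ true ∷ []) refl of λ ()
𝔽₂²-units {true ∷ false ∷ []} {false ∷ true ∷ []} _ = (true ∷ false ∷ [] , refl) , (false ∷ true ∷ [] , refl)
𝔽₂²-units {true ∷ false ∷ []} {true ∷ true ∷ []} _ = (true ∷ false ∷ [] , refl) , (true ∷ true ∷ [] , refl)
𝔽₂²-units {false ∷ true ∷ []} {true ∷ false ∷ []} _ = (false ∷ true ∷ [] , refl) , (true ∷ false ∷ [] , refl)
𝔽₂²-units {false ∷ true ∷ []} {true ∷ true ∷ []} _ = (true ∷ true ∷ [] , refl) , (true ∷ false ∷ [] , refl)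
𝔽₂²-units {true ∷ true ∷ []} {true ∷ false ∷ []} _ = (false ∷ true ∷ [] , refl) , (true ∷ true ∷ [] , refl)
𝔽₂²-units {true ∷ true ∷ []} {false ∷ true ∷ []} _ = (true ∷ true ∷ [] , refl) , (false ∷ true ∷ [] , refl)

-- Writing u, v in coordinates over gs reduces the claim to 𝔽₂².
independent-pair-spans : ∀ {n} {gs : Vec (Vect n) 2} {u v} → Independent (u ∷ v ∷ []) →
                         InSpan gs u → InSpan gs v → gs ⊆ˢ (u ∷ v ∷ [])
independent-pair-spans {gs = a ∷ b ∷ []} ind (cu , refl) (cv , refl) = ⊆ˢ-fromGenerators λ
  { fzero        → subst (InSpan _) (⊕-identityʳ a) (coordinates (proj₁ units))
  ; (fsuc fzero) → subst (InSpan _) (⊕-identityʳ b) (coordinates (proj₂ units))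
  }
  where
  coordinates : ∀ {e} → InSpan (cu ∷ cv ∷ []) e →
                InSpan (lin cu (a ∷ b ∷ []) ∷ lin cv (a ∷ b ∷ []) ∷ []) (lin e (a ∷ b ∷ []))
  coordinates = additive-InSpan (lin-additive (a ∷ b ∷ []))
  units : InSpan (cu ∷ cv ∷ []) (true ∷ false ∷ []) × InSpan (cu ∷ cv ∷ []) (false ∷ true ∷ [])
  units = 𝔽₂²-units (additive-Independent⁻ (lin-additive (a ∷ b ∷ [])) ind)

Adjacent-sym : ∀ {n} {X Y : G2 n} → Adjacent X Y → Adjacent Y X
Adjacent-sym (p , p-ind , p∈X , p∈Y , meet) = p , p-ind , p∈Y , p∈X , λ v v∈Y v∈X → meet v v∈X v∈Y

Adjacent-resp-SameSpace : ∀ {n} {X Y Z W : G2 n} →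
                          SameSpace (proj₁ Z) (proj₁ X) → SameSpace (proj₁ W) (proj₁ Y) →
                          Adjacent X Y → Adjacent Z W
Adjacent-resp-SameSpace Z≈X W≈Y (p , p-ind , p∈X , p∈Y , meet) =
  p , p-ind , from (Z≈X p) p∈X , from (W≈Y p) p∈Y ,
  λ v v∈Z v∈W → meet v (to (Z≈X v) v∈Z) (to (W≈Y v) v∈W)

replicate-∈S : ∀ {n} {X : G2 n} r → InA X → replicate n r ∈S X
replicate-∈S {X = X} false _ = InSpan-zero (proj₁ X)
replicate-∈S true 1∈X = 1∈X

shared-vector-is-ones : ∀ {n} {X Y : G2 n} {s x} → InC X → InC Y →
                        proj₁ X ⊆ˢ (s ∷ x ∷ []) → proj₁ Y ⊆ˢ (s ∷ (x ⊕ onesV) ∷ []) → s ≡ onesV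
shared-vector-is-ones {s = s} {x} cX cY X⊆ Y⊆ =
  lookup-extensional λ i → trans (coordinate i) (sym (lookup-replicate i true))
  where
  coordinate : ∀ i → lookup s i ≡ true
  coordinate i with lookup s i in sᵢ | lookup x i in xᵢ
  ... | true  | _     = refl
  ... | false | false =
    contradiction (λ v v∈X → InSpan-lookup≡false (X⊆ v v∈X) λ { fzero → sᵢ ; (fsuc fzero) → xᵢ })
                  (cX i)
  ... | false | true  =
    contradiction (λ v v∈Y → InSpan-lookup≡false (Y⊆ v v∈Y) λ { fzero → sᵢ ; (fsuc fzero) → x⊕1ᵢ })
                  (cY i)
    where
    x⊕1ᵢ : lookup (x ⊕ onesV) i ≡ false
    x⊕1ᵢ = trans (lookup-⊕ x onesV i) (cong₂ _xor_ xᵢ (lookup-replicate i true))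

independent-with-complement : ∀ {n} {Y : G2 n} {s x} → ¬ InA Y → s ≢ zeroV → s ∈S Y →
                              (x ⊕ onesV) ∈S Y → Independent (s ∷ x ∷ [])
independent-with-complement {Y = Y} {s} {x} 1∉Y s≢0 s∈Y x⊕1∈Y = independent-pair s≢0 x≢0 s≢x
  where
  x≢0 : x ≢ zeroV
  x≢0 x≡0 = 1∉Y (subst (_∈S Y) (trans (cong (_⊕ onesV) x≡0) (⊕-identityˡ onesV)) x⊕1∈Y)
  s≢x : s ≢ x
  s≢x s≡x = 1∉Y (subst (_∈S Y) (trans (cong (_⊕ (x ⊕ onesV)) s≡x) (⊕-cancelˡ x onesV))
                                (InSpan-⊕ s∈Y x⊕1∈Y))

-- If x + 1 ∈ Y then X = ⟨s, x⟩ and Y = ⟨s, x + 1⟩; wherever s vanishes, x or x + 1 vanishes too,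
-- which would put X or Y inside some Cᵢ. So s = 1, contradicting 1 ∉ X.
no-complement-across : ∀ {n} {X Y : G2 n} → InC X → InC Y → ¬ InA X → ¬ InA Y →
                       Adjacent X Y → ∀ x → x ∈S X → ¬ (x ⊕ onesV) ∈S Y
no-complement-across {X = X} {Y} cX cY 1∉X 1∉Y (s , s-ind , s∈X , s∈Y , _) x x∈X x⊕1∈Y =
  1∉X (subst (_∈S X) s≡1 s∈X)
  where
  s≢0 : s ≢ zeroV
  s≢0 = independent-single⁻ s-ind
  x⊕1⊕1∈X : ((x ⊕ onesV) ⊕ onesV) ∈S X
  x⊕1⊕1∈X = subst (_∈S X) (sym (⊕-cancelʳ x onesV)) x∈X
  s≡1 : s ≡ onesV
  s≡1 = shared-vector-is-ones {X = X} {Y} cX cY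
    (independent-pair-spans (independent-with-complement {Y = Y} 1∉Y s≢0 s∈Y x⊕1∈Y) s∈X x∈X)
    (independent-pair-spans (independent-with-complement {Y = X} 1∉X s≢0 s∈X x⊕1⊕1∈X) s∈Y x⊕1∈Y)

-- Projection along ⟨1⟩

record IsComplementOfOnes {n} (H : Vect n → Set) : Set where
  field
    ⊕-closed   : ∀ {x y} → H x → H y → H (x ⊕ y)
    ones∉      : ¬ H onesV
    shift-into : ∀ x → ∃ λ r → H (x ⊕ replicate n r)

module Projection {n} {H : Vect n → Set} (isComplement : IsComplementOfOnes H) where
  open IsComplementOfOnes isComplement

  offset : Vect n → Bool
  offset x = proj₁ (shift-into x)

  π : Vect n → Vect n
  π x = x ⊕ replicate n (offset x)

  π∈H : ∀ x → H (π x)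
  π∈H x = proj₂ (shift-into x)

  replicate∈H : ∀ {r} → H (replicate n r) → r ≡ false
  replicate∈H {false} _ = refl
  replicate∈H {true}  h = contradiction h ones∉

  π-unique : ∀ {x h r} → H h → x ⊕ h ≡ replicate n r → π x ≡ h
  π-unique {x} {h} {r} h∈H x⊕h≡r = ⊕≡zero⇒≡ (trans πx⊕h≡r′ (cong (replicate n) r′≡false))
    where
    R = replicate n (offset x)
    πx⊕h≡r′ : π x ⊕ h ≡ replicate n (offset x xor r)
    πx⊕h≡r′ = begin
      (x ⊕ R) ⊕ h        ≡⟨ cong (_⊕ h) (⊕-comm x R) ⟩
      (R ⊕ x) ⊕ h        ≡⟨ ⊕-assoc R x h ⟩
      R ⊕ (x ⊕ h)        ≡⟨ cong (R ⊕_) x⊕h≡r ⟩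
      R ⊕ replicate n r  ≡⟨ replicate-⊕ (offset x) r ⟩
      replicate n (offset x xor r) ∎
    r′≡false : offset x xor r ≡ false
    r′≡false = replicate∈H (subst H πx⊕h≡r′ (⊕-closed (π∈H x) h∈H))

  π-fix : ∀ {x} → H x → π x ≡ x
  π-fix {x} x∈H = π-unique x∈H (⊕-self x)

  π-shift : ∀ {x} → ¬ H x → π x ≡ x ⊕ onesV
  π-shift {x} x∉H = π-unique (shifted (shift-into x)) (⊕-cancelˡ x onesV)
    where
    shifted : ∃ (λ r → H (x ⊕ replicate n r)) → H (x ⊕ onesV)
    shifted (false , h) = contradiction (subst H (⊕-identityʳ x) h) x∉H
    shifted (true  , h) = h

  π-additive : Additive π
  π-additive x y = π-unique (⊕-closed (π∈H x) (π∈H y)) (begin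
    (x ⊕ y) ⊕ (π x ⊕ π y)  ≡⟨ ⊕-interchange x y (π x) (π y) ⟩
    (x ⊕ π x) ⊕ (y ⊕ π y)  ≡⟨ cong₂ _⊕_ (⊕-cancelˡ x _) (⊕-cancelˡ y _) ⟩
    replicate n (offset x) ⊕ replicate n (offset y)  ≡⟨ replicate-⊕ (offset x) (offset y) ⟩
    replicate n (offset x xor offset y) ∎)

  H-zero : H zeroV
  H-zero = subst H (⊕-self (π zeroV)) (⊕-closed (π∈H zeroV) (π∈H zeroV))

  π-kernel : ∀ {x} → π x ≡ zeroV → x ≡ zeroV ⊎ x ≡ onesV
  π-kernel {x} πx≡0 = Sum.map (trans x≡R) (trans x≡R) (replicate-cases (offset x))
    where
    x≡R : x ≡ replicate n (offset x)
    x≡R = ⊕≡zero⇒≡ πx≡0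
    replicate-cases : ∀ r → replicate n r ≡ zeroV ⊎ replicate n r ≡ onesV
    replicate-cases false = inj₁ refl
    replicate-cases true  = inj₂ refl

  π-fibre : ∀ {x y} → π x ≡ π y → y ≡ x ⊎ y ≡ x ⊕ onesV
  π-fibre {x} {y} πx≡πy = Sum.map (sym ∘ ⊕≡zero⇒≡) ⊕-moveˡ (π-kernel π[x⊕y]≡0)
    where
    π[x⊕y]≡0 : π (x ⊕ y) ≡ zeroV
    π[x⊕y]≡0 = trans (π-additive x y) (trans (cong (_⊕ π y) πx≡πy) (⊕-self (π y)))

  π-zero-on : ∀ {X : G2 n} {x} → ¬ InA X → x ∈S X → π x ≡ zeroV → x ≡ zeroV
  π-zero-on {X} 1∉X x∈X πx≡0 =
    [ id , (λ x≡1 → contradiction (subst (_∈S X) x≡1 x∈X) 1∉X) ]′ (π-kernel πx≡0)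

  π-∈ : ∀ {X : G2 n} {x} → InA X → x ∈S X → π x ∈S X
  π-∈ {X} {x} 1∈X x∈X = InSpan-⊕ x∈X (replicate-∈S {X = X} (offset x) 1∈X)

  π-∈⁻ : ∀ {X : G2 n} {x} → InA X → π x ∈S X → x ∈S X
  π-∈⁻ {X} {x} 1∈X πx∈X =
    subst (_∈S X) (⊕-cancelʳ x _) (InSpan-⊕ πx∈X (replicate-∈S {X = X} (offset x) 1∈X))

  πG : (X : G2 n) → ¬ InA X → G2 n
  πG X 1∉X = map π (proj₁ X) , additive-Independent π-additive
                                  (λ x x∈X → π-zero-on {X} 1∉X x∈X) (proj₂ X)

  independent-π : ∀ {X : G2 n} {s} → ¬ InA X → Independent (s ∷ []) → s ∈S X →
                  Independent (π s ∷ [])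
  independent-π {X} 1∉X s-ind s∈X =
    independent-single (independent-single⁻ s-ind ∘ π-zero-on {X} 1∉X s∈X)

  adjacent-πG-ones : ∀ {X Y : G2 n} → InA X → (1∉Y : ¬ InA Y) → Adjacent X Y → Adjacent X (πG Y 1∉Y)
  adjacent-πG-ones {X} {Y} 1∈X 1∉Y (s , s-ind , s∈X , s∈Y , X∩Y⊆⟨s⟩) =
    π s , independent-π {Y} 1∉Y s-ind s∈Y , π-∈ {X} 1∈X s∈X , additive-InSpan π-additive s∈Y , meet
    where
    meet : ∀ v → v ∈S X → v ∈S πG Y 1∉Y → InSpan (π s ∷ []) v
    meet v v∈X v∈πY with InSpan-map⁻ π-additive v∈πY
    ... | y , y∈Y , refl = additive-InSpan π-additive (X∩Y⊆⟨s⟩ y (π-∈⁻ {X} 1∈X v∈X) y∈Y)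

  adjacent-πG : ∀ {X Y : G2 n} (1∉X : ¬ InA X) (1∉Y : ¬ InA Y) →
                (∀ x → x ∈S X → ¬ (x ⊕ onesV) ∈S Y) →
                Adjacent X Y → Adjacent (πG X 1∉X) (πG Y 1∉Y)
  adjacent-πG {X} {Y} 1∉X 1∉Y no-complement (s , s-ind , s∈X , s∈Y , X∩Y⊆⟨s⟩) =
    π s , independent-π {Y} 1∉Y s-ind s∈Y ,
    additive-InSpan π-additive s∈X , additive-InSpan π-additive s∈Y , meet
    where
    meet : ∀ v → v ∈S πG X 1∉X → v ∈S πG Y 1∉Y → InSpan (π s ∷ []) v
    meet v v∈πX v∈πY with InSpan-map⁻ π-additive v∈πX | InSpan-map⁻ π-additive v∈πY
    ... | x , x∈X , refl | y , y∈Y , πx≡πy with π-fibre πx≡πy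
    ...   | inj₁ refl = additive-InSpan π-additive (X∩Y⊆⟨s⟩ x x∈X y∈Y)
    ...   | inj₂ refl = contradiction y∈Y (no-complement x x∈X)

-- The hyperplane H

parity : ∀ {k} → Vec Bool k → Bool
parity []      = false
parity (b ∷ c) = b xor parity c

parity-zero : ∀ k → parity (replicate k false) ≡ false
parity-zero zero    = refl
parity-zero (suc k) = parity-zero k

lin-map-true∷ : ∀ {n k} (c : Vec Bool k) (gs : Vec (Vect n) k) →
                lin c (map (true ∷_) gs) ≡ parity c ∷ lin c gs
lin-map-true∷ []          []       = refl
lin-map-true∷ (true ∷ c)  (g ∷ gs) = cong ((true ∷ g) ⊕_) (lin-map-true∷ c gs)
lin-map-true∷ (false ∷ c) (g ∷ gs) = lin-map-true∷ c gs

tabulate-true : ∀ n → tabulate {n = n} (λ _ → true) ≡ onesV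
tabulate-true zero    = refl
tabulate-true (suc n) = cong (true ∷_) (tabulate-true n)

tabulate-coUnit : ∀ n → tabulate (coUnit {suc n}) ≡ (false ∷ onesV) ∷ map (true ∷_) (tabulate coUnit)
tabulate-coUnit n = cong₂ _∷_ (cong (false ∷_) (tabulate-true n)) (tabulate-∘ (true ∷_) coUnit)

-- coUnit i = 1 + eᵢ, so Σ cᵢ (1 + eᵢ) = c + |c| · 1.
lin-coUnit : ∀ {n} (c : Vect n) → lin c (tabulate coUnit) ≡ c ⊕ replicate n (parity c)
lin-coUnit {zero}  []      = refl
lin-coUnit {suc n} (b ∷ c) = begin
  lin (b ∷ c) (tabulate coUnit)
    ≡⟨ cong (lin (b ∷ c)) (tabulate-coUnit n) ⟩
  (if b then (false ∷ onesV) ⊕ lin c (map (true ∷_) (tabulate coUnit))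
        else lin c (map (true ∷_) (tabulate coUnit)))
    ≡⟨ cong (λ r → if b then (false ∷ onesV) ⊕ r else r)
            (trans (lin-map-true∷ c (tabulate coUnit)) (cong (parity c ∷_) (lin-coUnit c))) ⟩
  (if b then (false ∷ onesV) ⊕ (parity c ∷ (c ⊕ replicate n (parity c)))
        else parity c ∷ (c ⊕ replicate n (parity c)))
    ≡⟨ add-head b (parity c) ⟩
  (b ∷ c) ⊕ replicate (suc n) (b xor parity c) ∎
  where
  add-head : ∀ b p → (if b then (false ∷ onesV) ⊕ (p ∷ (c ⊕ replicate n p))
                             else p ∷ (c ⊕ replicate n p))
                      ≡ (b ∷ c) ⊕ replicate (suc n) (b xor p)
  add-head false p     = refl
  add-head true  false = cong (false ∷_) (trans (cong (onesV ⊕_) (⊕-identityʳ c)) (⊕-comm onesV c))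
  add-head true  true  = cong (true ∷_) (trans (⊕-leftComm onesV c onesV) (cong (c ⊕_) (⊕-self onesV)))

module _ {m : ℕ} where

  private
    last : Fin (suc m)
    last = fromℕ m

  below-last : ∀ (c : Vect (suc m)) → lookup c last ≡ false →
               ∀ i → lookup c i ≡ true → suc (toℕ i) < suc m
  below-last c cₘ≡false i cᵢ≡true = s≤s (subst (_< m) (toℕ-lower₁ i m≢i) (toℕ<n (lower₁ i m≢i)))
    where
    m≢i : m ≢ toℕ i
    m≢i m≡i = case trans (sym cᵢ≡true) (trans (cong (lookup c) i≡last) cₘ≡false) of λ ()
      where
      i≡last : i ≡ last
      i≡last = toℕ-injective (trans (sym m≡i) (sym (toℕ-fromℕ m)))

  last≡false : ∀ (c : Vect (suc m)) → (∀ i → lookup c i ≡ true → suc (toℕ i) < suc m) →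
               lookup c last ≡ false
  last≡false c below with lookup c last in cₘ
  ... | false = refl
  ... | true  = contradiction (subst (λ k → suc k < suc m) (toℕ-fromℕ m) (below last cₘ)) (n≮n _)

  InH-⊕ : ∀ {x y : Vect (suc m)} → InH x → InH y → InH (x ⊕ y)
  InH-⊕ (c , c-below , refl) (d , d-below , refl) =
    c ⊕ d ,
    below-last (c ⊕ d) (trans (lookup-⊕ c d last) (cong₂ _xor_ (last≡false c c-below) (last≡false d d-below))) ,
    sym (lin-additive (tabulate coUnit) c d)

  ones∉InH : ¬ InH (onesV {suc m})
  ones∉InH (c , c-below , 1≡lin) = case trans (sym parity≡true) parity≡false of λ ()
    where
    1≡c⊕p : onesV ≡ c ⊕ replicate (suc m) (parity c)
    1≡c⊕p = trans 1≡lin (lin-coUnit c)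
    parity≡true : parity c ≡ true
    parity≡true = begin
      parity c                                               ≡⟨ cong (_xor parity c) (last≡false c c-below) ⟨
      lookup c last xor parity c                             ≡⟨ cong (lookup c last xor_) (lookup-replicate last (parity c)) ⟨
      lookup c last xor lookup (replicate _ (parity c)) last ≡⟨ lookup-⊕ c _ last ⟨
      lookup (c ⊕ replicate _ (parity c)) last               ≡⟨ cong (λ v → lookup v last) 1≡c⊕p ⟨
      lookup onesV last                                      ≡⟨ lookup-replicate last true ⟩
      true                                                   ∎
    c≡0 : c ≡ zeroV
    c≡0 = trans (sym (⊕-cancelʳ c onesV))
                (trans (cong (_⊕ onesV) (sym (subst (λ p → onesV ≡ c ⊕ replicate _ p) parity≡true 1≡c⊕p)))
                       (⊕-self onesV))
    parity≡false : parity c ≡ false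
    parity≡false = trans (cong parity c≡0) (parity-zero (suc m))

  -- With b the last coordinate of x, the coefficients x + b·1 avoid the last index.
  InH-shift-into : ∀ (x : Vect (suc m)) → ∃ λ r → InH (x ⊕ replicate (suc m) r)
  InH-shift-into x = b xor parity c , c , below-last c cₘ≡false , sym lin≡x⊕r
    where
    b = lookup x last
    c = x ⊕ replicate (suc m) b
    cₘ≡false : lookup c last ≡ false
    cₘ≡false = trans (lookup-⊕ x _ last) (trans (cong (b xor_) (lookup-replicate last b)) (xor-same b))
    lin≡x⊕r : lin c (tabulate coUnit) ≡ x ⊕ replicate (suc m) (b xor parity c)
    lin≡x⊕r = begin
      lin c (tabulate coUnit)                                        ≡⟨ lin-coUnit c ⟩
      (x ⊕ replicate _ b) ⊕ replicate _ (parity c)                   ≡⟨ ⊕-assoc x _ _ ⟩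
      x ⊕ (replicate _ b ⊕ replicate _ (parity c))                   ≡⟨ cong (x ⊕_) (replicate-⊕ b (parity c)) ⟩
      x ⊕ replicate (suc m) (b xor parity c)                         ∎

  InH-isComplementOfOnes : IsComplementOfOnes (InH {suc m})
  InH-isComplementOfOnes = record { ⊕-closed = InH-⊕ ; ones∉ = ones∉InH ; shift-into = InH-shift-into }

module InHProjection {m : ℕ} = Projection (InH-isComplementOfOnes {m})
open InHProjection

HMap-normalForm : ∀ {m} {X Z : G2 (suc m)} → HMap X Z →
                  (InA X × SameSpace (proj₁ Z) (proj₁ X))
                  ⊎ (Σ (¬ InA X) λ 1∉X → SameSpace (proj₁ Z) (proj₁ (πG X 1∉X)))
HMap-normalForm (inj₁ (inj₁ 1∈X , Z≈X)) = inj₁ (1∈X , Z≈X)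
HMap-normalForm {X = (a ∷ b ∷ []) , _} (inj₁ (inj₂ X⊆H , Z≈X)) =
  inj₂ (ones∉InH ∘ X⊆H onesV , subst (SameSpace _) (sym πab≡ab) Z≈X)
  where
  πab≡ab : map π (a ∷ b ∷ []) ≡ a ∷ b ∷ []
  πab≡ab = cong₂ (λ u w → u ∷ w ∷ [])
                 (π-fix (X⊆H a (true ∷ false ∷ [] , sym (⊕-identityʳ a))))
                 (π-fix (X⊆H b (false ∷ true ∷ [] , sym (⊕-identityʳ b))))
HMap-normalForm {X = X} (inj₂ ((_ , 1∉X , _) , p , q , p∈X , q∈X , p∉H , q∉H , p≢q , Z≈p′q′)) =
  inj₂ (1∉X , SameSpace-trans Z≈p′q′ (subst (λ gs → SameSpace gs (map π (proj₁ X))) πpq≡p′q′ πpq≈πX))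
  where
  ≢zero : ∀ {x} → ¬ InH x → x ≢ zeroV
  ≢zero x∉H x≡0 = x∉H (subst InH (sym x≡0) H-zero)
  πpq≡p′q′ : map π (p ∷ q ∷ []) ≡ (p ⊕ onesV) ∷ (q ⊕ onesV) ∷ []
  πpq≡p′q′ = cong₂ (λ u w → u ∷ w ∷ []) (π-shift p∉H) (π-shift q∉H)
  πpq≈πX : SameSpace (map π (p ∷ q ∷ [])) (map π (proj₁ X))
  πpq≈πX = ⊆ˢ-antisym
    (additive-⊆ˢ π-additive (⊆ˢ-fromGenerators λ { fzero → p∈X ; (fsuc fzero) → q∈X }))
    (additive-⊆ˢ π-additive (independent-pair-spans (independent-pair (≢zero p∉H) (≢zero q∉H) p≢q) p∈X q∈X))

lemma13 : (n : ℕ) → 4 ≤ n → (X Y Z W : G2 n) → InC X → InC Y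
    → Adjacent X Y → HMap X Z → HMap Y W → Adjacent Z W
lemma13 (suc m) _ X Y Z W cX cY X~Y hX hY with HMap-normalForm {X = X} {Z} hX | HMap-normalForm {X = Y} {W} hY
... | inj₁ (_ , Z≈X) | inj₁ (_ , W≈Y) = Adjacent-resp-SameSpace {X = X} {Y} {Z} {W} Z≈X W≈Y X~Y
... | inj₁ (1∈X , Z≈X) | inj₂ (1∉Y , W≈πY) =
  Adjacent-resp-SameSpace {X = X} {πG Y 1∉Y} {Z} {W} Z≈X W≈πY (adjacent-πG-ones {X = X} {Y} 1∈X 1∉Y X~Y)
... | inj₂ (1∉X , Z≈πX) | inj₁ (1∈Y , W≈Y) =
  Adjacent-resp-SameSpace {X = πG X 1∉X} {Y} {Z} {W} Z≈πX W≈Y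
    (Adjacent-sym {X = Y} {πG X 1∉X} (adjacent-πG-ones {X = Y} {X} 1∈Y 1∉X (Adjacent-sym {X = X} {Y} X~Y)))
... | inj₂ (1∉X , Z≈πX) | inj₂ (1∉Y , W≈πY) =
  Adjacent-resp-SameSpace {X = πG X 1∉X} {πG Y 1∉Y} {Z} {W} Z≈πX W≈πY
    (adjacent-πG {X = X} {Y} 1∉X 1∉Y (no-complement-across {X = X} {Y} cX cY 1∉X 1∉Y X~Y) X~Y)
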